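{- Let $G$ be a nontrivial finite abelian group of order $n$. The center of the power graph $\mathfrak{g}(G)$ has cardinality (1) $\varphi(n)+1$ if $G$ is cyclic and $n$ is not of the form $p^k$ with $p$ prime and $k$ a positive integer; (2) $n$ if $G$ is cyclic and $n=p^k$ for some prime $p$ and positive integer $k$; (3) $1$ if $G$ is not cyclic.
   Context: The power graph $\mathfrak{g}(G)$ has vertex set $G$, distinct $x,y$ adjacent iff $\langle x\rangle\le\langle y\rangle$ or $\langle y\rangle\le\langle x\rangle$. In a connected graph, the eccentricity of a vertex is its maximum distance to another vertex, the radius is the minimum eccentricity, and the center of the graph is the set of vertices whose eccentricity equals the radius. $\varphi$ is Euler's totient function. -}

module Defs where

open import Level using (Level; _⊔_)
open import Data.Nat using (ℕ; zero; suc; _≟_)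
open import Data.Nat.GCD using (gcd)
open import Data.Integer using (ℤ; +_; -[1+_])
open import Data.List using (List; length; filter; map; upTo)
open import Data.Fin using (Fin)
open import Data.Product using (Σ; ∃; _×_; _,_; proj₁)
open import Data.Sum using (_⊎_)
open import Relation.Nullary using (¬_)
open import Relation.Binary.Bundles using (Setoid)
open import Relation.Binary.PropositionalEquality using (_≡_)
import Relation.Binary.PropositionalEquality as ≡
open import Function.Bundles using (Inverse)
open import Algebra.Bundles using (AbelianGroup)

φ : ℕ → ℕ
φ n = length (filter (λ k → gcd k n ≟ 1) (map suc (upTo n)))

module PowerGraph {c ℓ : Level} (G : AbelianGroup c ℓ) where
  open AbelianGroup G

  powℕ : Carrier → ℕ → Carrier
  powℕ x zero    = ε
  powℕ x (suc k) = x ∙ powℕ x k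

  pow : Carrier → ℤ → Carrier
  pow x (+ k)     = powℕ x k
  pow x -[1+ k ]  = (powℕ x (suc k)) ⁻¹

  _∈⟨_⟩ : Carrier → Carrier → Set ℓ
  x ∈⟨ y ⟩ = ∃ λ (z : ℤ) → x ≈ pow y z

  _≤⟨⟩_ : Carrier → Carrier → Set (c ⊔ ℓ)
  x ≤⟨⟩ y = ∀ w → w ∈⟨ x ⟩ → w ∈⟨ y ⟩

  Adj : Carrier → Carrier → Set (c ⊔ ℓ)
  Adj x y = (¬ (x ≈ y)) × ((x ≤⟨⟩ y) ⊎ (y ≤⟨⟩ x))

  Within : ℕ → Carrier → Carrier → Set (c ⊔ ℓ)
  Within zero    x y = Level.Lift (c ⊔ ℓ) (x ≈ y)
  Within (suc k) x y = Within k x y ⊎ (∃ λ z → Adj x z × Within k z y)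

  EccLe : Carrier → ℕ → Set (c ⊔ ℓ)
  EccLe x e = ∀ y → Within e x y

  -- x is in the center: ecc(x) = radius, i.e. ecc(x) ≤ ecc(z) for every vertex z
  Central : Carrier → Set (c ⊔ ℓ)
  Central x = ∀ z e → EccLe z e → EccLe x e

  centerSetoid : Setoid (c ⊔ ℓ) ℓ
  centerSetoid = record
    { Carrier = Σ Carrier Central
    ; _≈_ = λ a b → proj₁ a ≈ proj₁ b
    ; isEquivalence = record { refl = refl ; sym = sym ; trans = trans }
    }

  CenterCard : ℕ → Set (c ⊔ ℓ)
  CenterCard m = Inverse centerSetoid (≡.setoid (Fin m))

  IsCyclic : Set (c ⊔ ℓ)
  IsCyclic = ∃ λ g → ∀ x → x ∈⟨ g ⟩

HasOrder : {c ℓ : Level} → AbelianGroup c ℓ → ℕ → Set (c ⊔ ℓ)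
HasOrder G n = Inverse (AbelianGroup.setoid G) (≡.setoid (Fin n))

module Submission where

-- The identity is adjacent to every other vertex, so the radius is 1 and the
-- center consists of the dominating vertices x: ⟨ y ⟩ ≤ ⟨ x ⟩ or ⟨ x ⟩ ≤ ⟨ y ⟩
-- for every y.
--
-- In a cyclic group ⟨ g ⟩ of order n, g ^ a dominates exactly when gcd(a, n) is
-- comparable under divisibility with every divisor of n. Divisors of a prime
-- power form a chain, so then every vertex is central; otherwise any divisor d
-- with 1 < d < n has an incomparable divisor, leaving the identity and the φ(n)
-- generators.
--
-- If a non-identity x dominates, G is cyclic. Take g of maximal order with
-- x ∈ ⟨ g ⟩ and show z ∈ ⟨ g ⟩ by induction on the order of z: for a prime
-- p ∣ ord z we get z ^ p = g ^ t, where p ∣ t since otherwise a suitable power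
-- of z times a power of g would have order larger than g; then w = z g ^ (- t/p)
-- satisfies w ^ p = 1, and as x dominates and is not the identity, w ∈ ⟨ x ⟩.

open import Defs
open import Level using (Level; _⊔_; lift; lower)
open import Algebra.Bundles using (AbelianGroup)
open import Data.Bool using (true; false)
open import Data.Fin using (Fin; toℕ; fromℕ<)
import Data.Fin.Properties as Fin
open import Data.Integer using (+_; -[1+_])
open import Data.List using ([]; _∷_; tabulate; [_]; _++_; _∷ʳ_; length; filter; map; upTo; applyUpTo)
open import Data.List.Properties using (upTo-∷ʳ; filter-++; length-++; map-upTo)
open import Data.List.Relation.Unary.All using (_∷_)
open import Data.List.Relation.Unary.All.Properties using (tabulate⁻)
open import Data.List.Extrema.Nat using (argmax; f[xs]≤f[argmax])
open import Data.Nat hiding (_⊔_)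
open import Data.Nat.Properties hiding (_≟_)
open import Data.Nat.Coprimality as Coprime using (Coprime; coprime-divisor)
open import Data.Nat.Divisibility
open import Data.Nat.DivMod using (m≡m%n+[m/n]*n; m%n<n)
open import Data.Nat.GCD using (gcd; gcd[m,n]∣m; gcd[m,n]∣n; gcd[m,n]≢0; gcd-greatest; gcd-GCD; module Bézout)
open import Data.Nat.Induction using (<-rec)
open import Data.Nat.ListAction using (product)
open import Data.Nat.Primality using (Prime; prime; prime⇒irreducible)
open import Data.Nat.Primality.Factorisation using (factorise)
open import Data.Product using (∃; ∃₂; _×_; _,_; proj₁; proj₂)
open import Data.Sum as Sum using (_⊎_; inj₁; inj₂)
open import Function.Base using (_∘_)
open import Function.Bundles using (Inverse)
open import Relation.Binary using (Setoid; tri<; tri≈; tri>)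
open import Relation.Binary.PropositionalEquality as ≡ hiding ([_]; setoid)
open import Relation.Nullary using (¬_; Dec; does; yes; no; contradiction)
import Relation.Nullary.Decidable as Dec
import Relation.Binary.Reasoning.Setoid as SetoidReasoning

IsPrimePower : ℕ → Set
IsPrimePower n = ∃ λ p → ∃ λ k → Prime p × k ≥ 1 × n ≡ p ^ k

prime>1 : ∀ {p} → Prime p → 1 < p
prime>1 {p} (prime _) = nonTrivial⇒n>1 p

∃-prime-∣ : ∀ {k} → 1 < k → ∃ λ p → Prime p × p ∣ k
∃-prime-∣ {k@(suc _)} 1<k with factorise k
... | record { factors = [] ; isFactorisation = k≡1 } = contradiction k≡1 (>⇒≢ 1<k)
... | record { factors = p ∷ ps ; isFactorisation = eq ; factorsPrime = pp ∷ _ } =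
  p , pp , divides (product ps) (trans eq (*-comm p (product ps)))

prime∤⇒coprime : ∀ {p m} → Prime p → ¬ p ∣ m → Coprime p m
prime∤⇒coprime pp p∤m {i} (i∣p , i∣m) with prime⇒irreducible pp i∣p
... | inj₁ i≡1 = i≡1
... | inj₂ refl = contradiction i∣m p∤m

coprime-* : ∀ {a b m} → Coprime a m → Coprime b m → Coprime (a * b) m
coprime-* {a} {b} {m} a⊥m b⊥m {i} (i∣ab , i∣m) = b⊥m (coprime-divisor i⊥a i∣ab , i∣m)
  where
  i⊥a : Coprime i a
  i⊥a (j∣i , j∣a) = a⊥m (j∣a , ∣-trans j∣i i∣m)

coprime-^ : ∀ {a m} k → Coprime a m → Coprime (a ^ k) m
coprime-^ zero    _   (i∣1 , _) = ∣1⇒≡1 i∣1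
coprime-^ (suc k) a⊥m = coprime-* a⊥m (coprime-^ k a⊥m)

coprime∧∣∧∣⇒*∣ : ∀ {a b d} → Coprime a b → a ∣ d → b ∣ d → a * b ∣ d
coprime∧∣∧∣⇒*∣ {a} {b} a⊥b (divides k refl) b∣ka =
  subst (a * b ∣_) (*-comm a k) (*-monoʳ-∣ a (coprime-divisor (Coprime.sym a⊥b) (subst (b ∣_) (*-comm k a) b∣ka)))

p-part : ∀ {p} → Prime p → ∀ m → .{{NonZero m}} → ∃₂ λ a m′ → m ≡ p ^ a * m′ × ¬ p ∣ m′
p-part {p} pp = <-rec _ go
  where
  go : ∀ m → (∀ {m′} → m′ < m → .{{NonZero m′}} → ∃₂ λ a m″ → m′ ≡ p ^ a * m″ × ¬ p ∣ m″) →
       .{{NonZero m}} → ∃₂ λ a m′ → m ≡ p ^ a * m′ × ¬ p ∣ m′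
  go m rec with p ∣? m
  ... | no p∤m = 0 , m , sym (+-identityʳ m) , p∤m
  ... | yes (divides q refl) with rec q<qp {{q≢0}}
    where
    q≢0 : NonZero q
    q≢0 = m*n≢0⇒m≢0 q
    q<qp : q < q * p
    q<qp = m<m*n q p {{q≢0}} (prime>1 pp)
  ... | a , m′ , refl , p∤m′ = suc a , m′ , trans (*-comm (p ^ a * m′) p) (sym (*-assoc p (p ^ a) m′)) , p∤m′

m∣n⇒gcd[m,n]≡m : ∀ {m n} → m ∣ n → gcd m n ≡ m
m∣n⇒gcd[m,n]≡m {m} {n} m∣n = ∣-antisym (gcd[m,n]∣m m n) (gcd-greatest ∣-refl m∣n)

prime∤∧∣p^k⇒≡1 : ∀ {p d} → Prime p → ¬ p ∣ d → ∀ k → d ∣ p ^ k → d ≡ 1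
prime∤∧∣p^k⇒≡1 pp p∤d zero    d∣1   = ∣1⇒≡1 d∣1
prime∤∧∣p^k⇒≡1 pp p∤d (suc k) d∣p^k = prime∤∧∣p^k⇒≡1 pp p∤d k
  (coprime-divisor (Coprime.sym (prime∤⇒coprime pp p∤d)) d∣p^k)

∣p^k-total : ∀ {p} → Prime p → ∀ k {d e} → d ∣ p ^ k → e ∣ p ^ k → d ∣ e ⊎ e ∣ d
∣p^k-total pp zero {d} {e} d∣1 _ = inj₁ (subst (_∣ e) (sym (∣1⇒≡1 d∣1)) (1∣ e))
∣p^k-total {p} pp (suc k) {d} {e} d∣ e∣ with p ∣? d | p ∣? e
... | no p∤d | _ = inj₁ (subst (_∣ e) (sym (prime∤∧∣p^k⇒≡1 pp p∤d (suc k) d∣)) (1∣ e))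
... | yes _ | no p∤e = inj₂ (subst (_∣ d) (sym (prime∤∧∣p^k⇒≡1 pp p∤e (suc k) e∣)) (1∣ d))
... | yes (divides d′ refl) | yes (divides e′ refl) =
  Sum.map (*-monoˡ-∣ {d′} {e′} p) (*-monoˡ-∣ {e′} {d′} p) (∣p^k-total pp k (cancel d∣) (cancel e∣))
  where
  instance _ = >-nonZero (<-trans z<s (prime>1 pp))
  cancel : ∀ {x} → x * p ∣ p * p ^ k → x ∣ p ^ k
  cancel {x} x*p∣ = *-cancelʳ-∣ p (subst (x * p ∣_) (*-comm p (p ^ k)) x*p∣)

¬prime-power⇒incomparable-divisor : ∀ {n d} → ¬ IsPrimePower n → d ∣ n → 1 < d → d < n →
  ∃ λ e → e ∣ n × ¬ d ∣ e × ¬ e ∣ d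
¬prime-power⇒incomparable-divisor {n} {d} ¬pp d∣n 1<d d<n
  with p , pp , p∣d ← ∃-prime-∣ 1<d
  with v , m , n≡p^v*m , p∤m ← p-part pp n {{>-nonZero (<-trans z<s (<-trans 1<d d<n))}}
  with m ∣? d
... | no m∤d = m , divides (p ^ v) n≡p^v*m , (λ d∣m → p∤m (∣-trans p∣d d∣m)) , m∤d
... | yes m∣d = p ^ v , divides m (trans n≡p^v*m (*-comm (p ^ v) m)) , d∤p^v , p^v∤d
  where
  n≢p^w*1 : ∀ w → n ≢ p ^ w * 1
  n≢p^w*1 zero    n≡1 = <⇒≢ (<-trans 1<d d<n) (sym n≡1)
  n≢p^w*1 (suc w) n≡  = ¬pp (p , suc w , pp , s≤s z≤n , trans n≡ (*-identityʳ _))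
  m≢1 : m ≢ 1
  m≢1 refl = n≢p^w*1 v n≡p^v*m
  d∤p^v : ¬ d ∣ p ^ v
  d∤p^v d∣p^v = m≢1 (prime∤∧∣p^k⇒≡1 pp p∤m v (∣-trans m∣d d∣p^v))
  p^v∤d : ¬ p ^ v ∣ d
  p^v∤d p^v∣d = <⇒≱ d<n (∣⇒≤ {{>-nonZero (<-trans z<s 1<d)}}
    (subst (_∣ d) (sym n≡p^v*m) (coprime∧∣∧∣⇒*∣ (coprime-^ v (prime∤⇒coprime pp p∤m)) p^v∣d m∣d)))

∃-least : ∀ {q} {P : ℕ → Set q} → (∀ k → Dec (P k)) → ∀ {N} → P N →
          ∃ λ k → P k × (∀ {j} → j < k → ¬ P j)
∃-least {P = P} P? {N} pN with search (suc N)
  where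
  search : ∀ N → (∃ λ k → k < N × P k × (∀ {j} → j < k → ¬ P j)) ⊎ (∀ {j} → j < N → ¬ P j)
  search zero = inj₂ λ ()
  search (suc N) with search N
  ... | inj₁ (k , k<N , pk , below) = inj₁ (k , m<n⇒m<1+n k<N , pk , below)
  ... | inj₂ none with P? N
  ...   | yes pN = inj₁ (N , n<1+n N , pN , none)
  ...   | no ¬pN = inj₂ λ j<1+N → Sum.[ none , (λ { refl → ¬pN }) ] (m<1+n⇒m<n∨m≡n j<1+N)
... | inj₁ (k , _ , pk , below) = k , pk , below
... | inj₂ none = contradiction pN (none (n<1+n N))

module Counting {q} {Q : ℕ → Set q} (Q? : ∀ k → Dec (Q k)) where

  count : ℕ → ℕ
  count zero = 0
  count (suc N) with Q? N
  ... | yes _ = suc (count N)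
  ... | no  _ = count N

  count≡length-filter : ∀ N → count N ≡ length (filter Q? (upTo N))
  count≡length-filter zero = refl
  count≡length-filter (suc N) = begin
    count (suc N)                                          ≡⟨ step ⟩
    length (filter Q? (upTo N)) + length (filter Q? [ N ]) ≡⟨ length-++ (filter Q? (upTo N)) ⟨
    length (filter Q? (upTo N) ++ filter Q? [ N ])         ≡⟨ cong length (filter-++ Q? (upTo N) [ N ]) ⟨
    length (filter Q? (upTo N ∷ʳ N))                       ≡⟨ cong (length ∘ filter Q?) (upTo-∷ʳ N) ⟩
    length (filter Q? (upTo (suc N)))                      ∎
    where
    open ≡-Reasoning
    step : count (suc N) ≡ length (filter Q? (upTo N)) + length (filter Q? [ N ])
    step with Q? N
    ... | yes _ = trans (cong suc (count≡length-filter N)) (+-comm 1 _)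
    ... | no  _ = trans (count≡length-filter N) (sym (+-identityʳ _))

  count-accept : ∀ {k} → Q k → count (suc k) ≡ suc (count k)
  count-accept {k} qk with Q? k
  ... | yes _  = refl
  ... | no ¬qk = contradiction qk ¬qk

  count-reject : ∀ {k} → ¬ Q k → count (suc k) ≡ count k
  count-reject {k} ¬qk with Q? k
  ... | yes qk = contradiction qk ¬qk
  ... | no  _  = refl

  count-suc-≥ : ∀ N → count N ≤ count (suc N)
  count-suc-≥ N with Q? N
  ... | yes _ = n≤1+n _
  ... | no  _ = ≤-refl

  count-mono : ∀ {a b} → a ≤ b → count a ≤ count b
  count-mono = mono′ ∘ ≤⇒≤′
    where
    mono′ : ∀ {a b} → a ≤′ b → count a ≤ count b
    mono′ ≤′-refl         = ≤-refl
    mono′ (≤′-step a≤′b) = ≤-trans (mono′ a≤′b) (count-suc-≥ _)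

  count-< : ∀ {a b} → Q a → a < b → count a < count b
  count-< qa a<b = ≤-trans (≤-reflexive (sym (count-accept qa))) (count-mono a<b)

  count-injective : ∀ {a b} → Q a → Q b → count a ≡ count b → a ≡ b
  count-injective {a} {b} qa qb eq with <-cmp a b
  ... | tri< a<b _ _ = contradiction eq (<⇒≢ (count-< qa a<b))
  ... | tri≈ _ a≡b _ = a≡b
  ... | tri> _ _ b<a = contradiction eq (>⇒≢ (count-< qb b<a))

  count-surjective : ∀ N {i} → i < count N → ∃ λ k → k < N × Q k × count k ≡ i
  count-surjective (suc N) {i} i<count with Q? N
  ... | no _ = let k , k<N , qk , eq = count-surjective N i<count in k , m<n⇒m<1+n k<N , qk , eq
  ... | yes qN with m≤n⇒m<n∨m≡n (s≤s⁻¹ i<count)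
  ...   | inj₂ refl = N , n<1+n N , qN , refl
  ...   | inj₁ i<c = let k , k<N , qk , eq = count-surjective N i<c in k , m<n⇒m<1+n k<N , qk , eq

  record Indexing {a ℓ} (S : Setoid a ℓ) (N : ℕ) : Set (a ⊔ ℓ ⊔ q) where
    open Setoid S
    field
      index           : Carrier → ℕ
      index-cong      : ∀ {x y} → x ≈ y → index x ≡ index y
      index-injective : ∀ {x y} → index x ≡ index y → x ≈ y
      index-<         : ∀ x → index x < N
      index-valid     : ∀ x → Q (index x)
      element         : ∀ k → k < N → Q k → Carrier
      index-element   : ∀ k k<N qk → index (element k k<N qk) ≡ k

  indexing⇒↔Fin-count : ∀ {a ℓ} {S : Setoid a ℓ} {N} → Indexing S N → Inverse S (≡.setoid (Fin (count N)))
  indexing⇒↔Fin-count {S = S} {N} I = record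
    { to        = to
    ; from      = from
    ; to-cong   = λ x≈y → Fin.toℕ-injective (trans (toℕ-to _) (trans (cong count (index-cong x≈y)) (sym (toℕ-to _))))
    ; from-cong = λ { refl → S.refl }
    ; inverse   = (λ {i} → to-from i) , from-to
    }
    where
    module S = Setoid S
    open Indexing I

    to : S.Carrier → Fin (count N)
    to x = fromℕ< (count-< (index-valid x) (index-< x))

    toℕ-to : ∀ x → toℕ (to x) ≡ count (index x)
    toℕ-to x = Fin.toℕ-fromℕ< _

    from : Fin (count N) → S.Carrier
    from i = let k , k<N , qk , _ = count-surjective N (Fin.toℕ<n i) in element k k<N qk

    index-from : ∀ i → count (index (from i)) ≡ toℕ i
    index-from i with k , k<N , qk , eq ← count-surjective N (Fin.toℕ<n i) =
      trans (cong count (index-element k k<N qk)) eq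

    to-from : ∀ i {x} → x S.≈ from i → to x ≡ i
    to-from i x≈ = Fin.toℕ-injective (trans (toℕ-to _) (trans (cong count (index-cong x≈)) (index-from i)))

    from-to : ∀ {x i} → i ≡ to x → from i S.≈ x
    from-to {x} refl = index-injective (count-injective (index-valid _) (index-valid x)
      (trans (index-from (to x)) (toℕ-to x)))

ZeroOrCoprime : ℕ → ℕ → Set
ZeroOrCoprime n k = k ≡ 0 ⊎ gcd k n ≡ 1

zeroOrCoprime? : ∀ n k → Dec (ZeroOrCoprime n k)
zeroOrCoprime? n zero    = yes (inj₁ refl)
zeroOrCoprime? n (suc k) = Dec.map′ inj₂ (λ { (inj₂ e) → e }) (gcd (suc k) n ≟ 1)

module _ (n : ℕ) where
  open Counting (zeroOrCoprime? n)

  filter-zeroOrCoprime-suc : ∀ xs → filter (zeroOrCoprime? n) (map suc xs) ≡ filter (λ k → gcd k n ≟ 1) (map suc xs)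
  filter-zeroOrCoprime-suc [] = refl
  filter-zeroOrCoprime-suc (x ∷ xs) with does (gcd (suc x) n ≟ 1)
  ... | true  = cong (suc x ∷_) (filter-zeroOrCoprime-suc xs)
  ... | false = filter-zeroOrCoprime-suc xs

  count-zeroOrCoprime : n > 1 → count n ≡ φ n + 1
  count-zeroOrCoprime n>1 = begin
    count n                                                       ≡⟨ count-reject ¬zeroOrCoprime[n] ⟨
    count (suc n)                                                 ≡⟨ count≡length-filter (suc n) ⟩
    suc (length (filter (zeroOrCoprime? n) (applyUpTo suc n)))    ≡⟨ cong (suc ∘ length ∘ filter (zeroOrCoprime? n)) (map-upTo suc n) ⟨
    suc (length (filter (zeroOrCoprime? n) (map suc (upTo n))))  ≡⟨ cong (suc ∘ length) (filter-zeroOrCoprime-suc (upTo n)) ⟩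
    suc (φ n)                                                     ≡⟨ +-comm 1 (φ n) ⟩
    φ n + 1                                                       ∎
    where
    open ≡-Reasoning
    ¬zeroOrCoprime[n] : ¬ ZeroOrCoprime n n
    ¬zeroOrCoprime[n] (inj₁ n≡0)   = contradiction n≡0 (>⇒≢ (<-trans z<s n>1))
    ¬zeroOrCoprime[n] (inj₂ gcd≡1) = contradiction (trans (sym (m∣n⇒gcd[m,n]≡m ∣-refl)) gcd≡1) (>⇒≢ n>1)

module Powers {c ℓ} (G : AbelianGroup c ℓ) where
  open AbelianGroup G renaming (refl to ≈-refl; sym to ≈-sym; trans to ≈-trans)
  open PowerGraph G
  open import Algebra.Properties.Group group using (inverseˡ-unique)
  open import Algebra.Properties.CommutativeMonoid.Mult commutativeMonoid
    using (×-congʳ; ×-homo-+; ×-assocˡ; ×-distrib-+)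
    renaming (_×_ to _·_)
  open import Relation.Binary.Reasoning.Setoid setoid

  powℕ≈· : ∀ x k → powℕ x k ≈ k · x
  powℕ≈· x zero    = ≈-refl
  powℕ≈· x (suc k) = ∙-congˡ (powℕ≈· x k)

  pow-cong : ∀ k {x y} → x ≈ y → powℕ x k ≈ powℕ y k
  pow-cong k {x} {y} x≈y = begin
    powℕ x k ≈⟨ powℕ≈· x k ⟩
    k · x    ≈⟨ ×-congʳ k x≈y ⟩
    k · y    ≈⟨ powℕ≈· y k ⟨
    powℕ y k ∎

  pow-+ : ∀ x a b → powℕ x (a + b) ≈ powℕ x a ∙ powℕ x b
  pow-+ x a b = begin
    powℕ x (a + b)        ≈⟨ powℕ≈· x (a + b) ⟩
    (a + b) · x           ≈⟨ ×-homo-+ x a b ⟩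
    a · x ∙ b · x         ≈⟨ ∙-cong (powℕ≈· x a) (powℕ≈· x b) ⟨
    powℕ x a ∙ powℕ x b   ∎

  pow-* : ∀ x a b → powℕ x (a * b) ≈ powℕ (powℕ x b) a
  pow-* x a b = begin
    powℕ x (a * b)        ≈⟨ powℕ≈· x (a * b) ⟩
    (a * b) · x           ≈⟨ ×-assocˡ x a b ⟨
    a · (b · x)           ≈⟨ ×-congʳ a (powℕ≈· x b) ⟨
    a · powℕ x b          ≈⟨ powℕ≈· (powℕ x b) a ⟨
    powℕ (powℕ x b) a     ∎

  pow-∙ : ∀ x y k → powℕ (x ∙ y) k ≈ powℕ x k ∙ powℕ y k
  pow-∙ x y k = begin
    powℕ (x ∙ y) k        ≈⟨ powℕ≈· (x ∙ y) k ⟩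
    k · (x ∙ y)           ≈⟨ ×-distrib-+ x y k ⟩
    k · x ∙ k · y         ≈⟨ ∙-cong (powℕ≈· x k) (powℕ≈· y k) ⟨
    powℕ x k ∙ powℕ y k   ∎

  pow-ε : ∀ k → powℕ ε k ≈ ε
  pow-ε zero    = ≈-refl
  pow-ε (suc k) = ≈-trans (identityˡ _) (pow-ε k)

  pow-⁻¹ : ∀ x k → powℕ (x ⁻¹) k ≈ powℕ x k ⁻¹
  pow-⁻¹ x k = inverseˡ-unique _ _ (begin
    powℕ (x ⁻¹) k ∙ powℕ x k ≈⟨ pow-∙ (x ⁻¹) x k ⟨
    powℕ (x ⁻¹ ∙ x) k        ≈⟨ pow-cong k (inverseˡ x) ⟩
    powℕ ε k                 ≈⟨ pow-ε k ⟩
    ε                        ∎)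

  -- Membership in ⟨ x ⟩ using natural exponents only; in a finite group it is
  -- equivalent to _∈⟨_⟩ (see ∈⟨⟩⇒∈ℕ below).
  infix 4 _∈ℕ⟨_⟩

  _∈ℕ⟨_⟩ : Carrier → Carrier → Set ℓ
  y ∈ℕ⟨ x ⟩ = ∃ λ k → y ≈ powℕ x k

  ∈ℕ-respˡ : ∀ {y y′ x} → y ≈ y′ → y ∈ℕ⟨ x ⟩ → y′ ∈ℕ⟨ x ⟩
  ∈ℕ-respˡ y≈y′ (k , y≈) = k , ≈-trans (≈-sym y≈y′) y≈

  ∈ℕ-respʳ : ∀ {y x x′} → x ≈ x′ → y ∈ℕ⟨ x ⟩ → y ∈ℕ⟨ x′ ⟩
  ∈ℕ-respʳ x≈x′ (k , y≈) = k , ≈-trans y≈ (pow-cong k x≈x′)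

  ∈ℕ-refl : ∀ x → x ∈ℕ⟨ x ⟩
  ∈ℕ-refl x = 1 , ≈-sym (identityʳ x)

  ∈ℕ-trans : ∀ {z y x} → z ∈ℕ⟨ y ⟩ → y ∈ℕ⟨ x ⟩ → z ∈ℕ⟨ x ⟩
  ∈ℕ-trans {x = x} (j , z≈) (k , y≈) = j * k , ≈-trans z≈ (≈-trans (pow-cong j y≈) (≈-sym (pow-* x j k)))

  ε∈ℕ : ∀ x → ε ∈ℕ⟨ x ⟩
  ε∈ℕ x = 0 , ≈-refl

  pow∈ℕ : ∀ x k → powℕ x k ∈ℕ⟨ x ⟩
  pow∈ℕ x k = k , ≈-refl

  ∈ℕ-∙ : ∀ {y z x} → y ∈ℕ⟨ x ⟩ → z ∈ℕ⟨ x ⟩ → y ∙ z ∈ℕ⟨ x ⟩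
  ∈ℕ-∙ {x = x} (a , y≈) (b , z≈) = a + b , ≈-trans (∙-cong y≈ z≈) (≈-sym (pow-+ x a b))

module Order {c ℓ} (G : AbelianGroup c ℓ) {n} (H : HasOrder G n) where
  open AbelianGroup G renaming (refl to ≈-refl; sym to ≈-sym; trans to ≈-trans)
  open PowerGraph G
  open Powers G
  open import Algebra.Properties.Group group using (identityˡ-unique; inverseˡ-unique; inverseʳ-unique)
  open import Relation.Binary.Reasoning.Setoid setoid
  private module H = Inverse H

  to-injective : ∀ {x y} → H.to x ≡ H.to y → x ≈ y
  to-injective eq = ≈-trans (≈-sym (H.inverseʳ refl)) (≈-trans (H.from-cong eq) (H.inverseʳ refl))

  _≈?_ : ∀ x y → Dec (x ≈ y)
  x ≈? y = Dec.map′ to-injective H.to-cong (H.to x Fin.≟ H.to y)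

  ∃-period : ∀ x → ∃ λ k → powℕ x (suc k) ≈ ε
  ∃-period x with i , j , i<j , xⁱ≡xʲ ← Fin.pigeonhole (n<1+n n) (λ i → H.to (powℕ x (toℕ i))) =
    k , identityˡ-unique _ _ (begin
      powℕ x (suc k) ∙ powℕ x (toℕ i) ≈⟨ pow-+ x (suc k) (toℕ i) ⟨
      powℕ x (suc k + toℕ i)          ≡⟨ cong (powℕ x) (trans (sym (+-suc k (toℕ i))) (m∸n+n≡m i<j)) ⟩
      powℕ x (toℕ j)                  ≈⟨ to-injective xⁱ≡xʲ ⟨
      powℕ x (toℕ i)                  ∎)
    where k = toℕ j ∸ suc (toℕ i)

  private
    minimal-period : ∀ x → ∃ λ k → powℕ x (suc k) ≈ ε × (∀ {j} → j < k → powℕ x (suc j) ≉ ε)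
    minimal-period x = ∃-least (λ k → powℕ x (suc k) ≈? ε) {proj₁ (∃-period x)} (proj₂ (∃-period x))

  opaque
    ord : Carrier → ℕ
    ord x = suc (proj₁ (minimal-period x))

    instance
      ord-nonZero : ∀ {x} → NonZero (ord x)
      ord-nonZero = _

    pow-ord : ∀ x → powℕ x (ord x) ≈ ε
    pow-ord x = proj₁ (proj₂ (minimal-period x))

    pow≉ε-below-ord : ∀ x {j} → 0 < j → j < ord x → powℕ x j ≉ ε
    pow≉ε-below-ord x {suc j} _ (s≤s j<k) = proj₂ (proj₂ (minimal-period x)) j<k

    ⁻¹≈pow[ord∸1] : ∀ x → x ⁻¹ ≈ powℕ x (ord x ∸ 1)
    ⁻¹≈pow[ord∸1] x = ≈-sym (inverseʳ-unique x _ (pow-ord x))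

  ord∣⇒pow≈ε : ∀ x {j} → ord x ∣ j → powℕ x j ≈ ε
  ord∣⇒pow≈ε x (divides q refl) = begin
    powℕ x (q * ord x)      ≈⟨ pow-* x q (ord x) ⟩
    powℕ (powℕ x (ord x)) q ≈⟨ pow-cong q (pow-ord x) ⟩
    powℕ ε q                ≈⟨ pow-ε q ⟩
    ε                       ∎

  pow-mod : ∀ x a → powℕ x a ≈ powℕ x (a % ord x)
  pow-mod x a = begin
    powℕ x a                                        ≡⟨ cong (powℕ x) (m≡m%n+[m/n]*n a (ord x)) ⟩
    powℕ x (a % ord x + a / ord x * ord x)          ≈⟨ pow-+ x (a % ord x) (a / ord x * ord x) ⟩
    powℕ x (a % ord x) ∙ powℕ x (a / ord x * ord x) ≈⟨ ∙-congˡ (ord∣⇒pow≈ε x (n∣m*n (a / ord x))) ⟩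
    powℕ x (a % ord x) ∙ ε                          ≈⟨ identityʳ _ ⟩
    powℕ x (a % ord x)                              ∎

  pow≈ε⇒ord∣ : ∀ x {j} → powℕ x j ≈ ε → ord x ∣ j
  pow≈ε⇒ord∣ x {j} xʲ≈ε with j % ord x ≟ 0
  ... | yes r≡0 = m%n≡0⇒n∣m j (ord x) r≡0
  ... | no  r≢0 = contradiction (≈-trans (≈-sym (pow-mod x j)) xʲ≈ε)
                    (pow≉ε-below-ord x (n≢0⇒n>0 r≢0) (m%n<n j (ord x)))

  private
    pow-injective-≤ : ∀ x {a b} → a ≤ b → b < ord x → powℕ x a ≈ powℕ x b → a ≡ b
    pow-injective-≤ x {a} {b} a≤b b<o xᵃ≈xᵇ with b ∸ a ≟ 0
    ... | yes b∸a≡0 = ≤-antisym a≤b (m∸n≡0⇒m≤n b∸a≡0)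
    ... | no  b∸a≢0 = contradiction (identityˡ-unique _ _ (begin
        powℕ x (b ∸ a) ∙ powℕ x a ≈⟨ pow-+ x (b ∸ a) a ⟨
        powℕ x (b ∸ a + a)        ≡⟨ cong (powℕ x) (m∸n+n≡m a≤b) ⟩
        powℕ x b                  ≈⟨ xᵃ≈xᵇ ⟨
        powℕ x a                  ∎))
      (pow≉ε-below-ord x (n≢0⇒n>0 b∸a≢0) (≤-<-trans (m∸n≤m b a) b<o))

  pow-injective : ∀ x {a b} → a < ord x → b < ord x → powℕ x a ≈ powℕ x b → a ≡ b
  pow-injective x {a} {b} a<o b<o xᵃ≈xᵇ with ≤-total a b
  ... | inj₁ a≤b = pow-injective-≤ x a≤b b<o xᵃ≈xᵇ
  ... | inj₂ b≤a = sym (pow-injective-≤ x b≤a a<o (≈-sym xᵃ≈xᵇ))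

  ∈ℕ-⁻¹ : ∀ {y x} → y ∈ℕ⟨ x ⟩ → y ⁻¹ ∈ℕ⟨ x ⟩
  ∈ℕ-⁻¹ {y} y∈ = ∈ℕ-trans (ord y ∸ 1 , ⁻¹≈pow[ord∸1] y) y∈

  ∈⟨⟩⇒∈ℕ : ∀ {y x} → y ∈⟨ x ⟩ → y ∈ℕ⟨ x ⟩
  ∈⟨⟩⇒∈ℕ (+ k , y≈)        = k , y≈
  ∈⟨⟩⇒∈ℕ {x = x} (-[1+ k ] , y≈) = ∈ℕ-respˡ (≈-sym y≈) (∈ℕ-⁻¹ (pow∈ℕ x (suc k)))

  ∈ℕ⇒∈⟨⟩ : ∀ {y x} → y ∈ℕ⟨ x ⟩ → y ∈⟨ x ⟩
  ∈ℕ⇒∈⟨⟩ (k , y≈) = + k , y≈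

  ∈ℕ⇒ord∣ : ∀ {y x} → y ∈ℕ⟨ x ⟩ → ord y ∣ ord x
  ∈ℕ⇒ord∣ {y} {x} (k , y≈xᵏ) = pow≈ε⇒ord∣ y (begin
    powℕ y (ord x)          ≈⟨ pow-cong (ord x) y≈xᵏ ⟩
    powℕ (powℕ x k) (ord x) ≈⟨ pow-* x (ord x) k ⟨
    powℕ x (ord x * k)      ≈⟨ ord∣⇒pow≈ε x (m∣m*n k) ⟩
    ε                       ∎)

  ord-cong : ∀ {x y} → x ≈ y → ord x ≡ ord y
  ord-cong {x} {y} x≈y = ∣-antisym (∈ℕ⇒ord∣ (∈ℕ-respʳ x≈y (∈ℕ-refl x))) (∈ℕ⇒ord∣ (∈ℕ-respʳ (≈-sym x≈y) (∈ℕ-refl y)))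

  ord≡1⇒≈ε : ∀ {x} → ord x ≡ 1 → x ≈ ε
  ord≡1⇒≈ε {x} o≡1 = ≈-trans (≈-sym (identityʳ x)) (ord∣⇒pow≈ε x (subst (_∣ 1) (sym o≡1) ∣-refl))

  ord-pow : ∀ x {d c} → ord x ≡ d * c → ord (powℕ x c) ≡ d
  ord-pow x {d} {c} o≡dc = ∣-antisym ord∣d d∣ord
    where
    instance
      c≢0 : NonZero c
      c≢0 = m*n≢0⇒n≢0 d {{subst NonZero o≡dc ord-nonZero}}
    ord∣d : ord (powℕ x c) ∣ d
    ord∣d = pow≈ε⇒ord∣ (powℕ x c) (begin
      powℕ (powℕ x c) d ≈⟨ pow-* x d c ⟨
      powℕ x (d * c)    ≡⟨ cong (powℕ x) o≡dc ⟨
      powℕ x (ord x)    ≈⟨ pow-ord x ⟩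
      ε                 ∎)
    d∣ord : d ∣ ord (powℕ x c)
    d∣ord = *-cancelʳ-∣ c (subst (_∣ ord (powℕ x c) * c) o≡dc (pow≈ε⇒ord∣ x (begin
      powℕ x (ord (powℕ x c) * c)      ≈⟨ pow-* x (ord (powℕ x c)) c ⟩
      powℕ (powℕ x c) (ord (powℕ x c)) ≈⟨ pow-ord (powℕ x c) ⟩
      ε                                ∎)))

  private
    ord∣ord*ord[∙] : ∀ x y → ord x ∣ ord y * ord (x ∙ y)
    ord∣ord*ord[∙] x y = pow≈ε⇒ord∣ x (begin
      powℕ x k            ≈⟨ identityʳ _ ⟨
      powℕ x k ∙ ε        ≈⟨ ∙-congˡ (ord∣⇒pow≈ε y (m∣m*n (ord (x ∙ y)))) ⟨
      powℕ x k ∙ powℕ y k ≈⟨ pow-∙ x y k ⟨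
      powℕ (x ∙ y) k      ≈⟨ ord∣⇒pow≈ε (x ∙ y) (n∣m*n (ord y)) ⟩
      ε                   ∎)
      where k = ord y * ord (x ∙ y)

  ord-∙-coprime : ∀ x y → Coprime (ord x) (ord y) → ord x * ord y ∣ ord (x ∙ y)
  ord-∙-coprime x y ox⊥oy = coprime∧∣∧∣⇒*∣ ox⊥oy
    (coprime-divisor ox⊥oy (ord∣ord*ord[∙] x y))
    (coprime-divisor (Coprime.sym ox⊥oy) (subst (λ m → ord y ∣ ord x * m) (ord-cong (comm y x)) (ord∣ord*ord[∙] y x)))

  gcd∣⇒pow∈ℕ⟨pow⟩ : ∀ g {a b} → gcd b (ord g) ∣ a → powℕ g a ∈ℕ⟨ powℕ g b ⟩
  gcd∣⇒pow∈ℕ⟨pow⟩ g {b = b} (divides q refl) =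
    ∈ℕ-trans (∈ℕ-respˡ (≈-sym (pow-* g q d)) (pow∈ℕ (powℕ g d) q)) gᵈ∈⟨gᵇ⟩
    where
    d = gcd b (ord g)
    gᵈ∈⟨gᵇ⟩ : powℕ g d ∈ℕ⟨ powℕ g b ⟩
    gᵈ∈⟨gᵇ⟩ with Bézout.identity (gcd-GCD b (ord g))
    ... | Bézout.+- u v d+v·o≡u·b = u , (begin
      powℕ g d                      ≈⟨ identityʳ _ ⟨
      powℕ g d ∙ ε                  ≈⟨ ∙-congˡ (ord∣⇒pow≈ε g (n∣m*n v)) ⟨
      powℕ g d ∙ powℕ g (v * ord g) ≈⟨ pow-+ g d (v * ord g) ⟨
      powℕ g (d + v * ord g)        ≡⟨ cong (powℕ g) d+v·o≡u·b ⟩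
      powℕ g (u * b)                ≈⟨ pow-* g u b ⟩
      powℕ (powℕ g b) u             ∎)
    ... | Bézout.-+ u v d+u·b≡v·o = ∈ℕ-respˡ (≈-sym (inverseˡ-unique _ _ (begin
      powℕ g d ∙ powℕ (powℕ g b) u ≈⟨ ∙-congˡ (pow-* g u b) ⟨
      powℕ g d ∙ powℕ g (u * b)    ≈⟨ pow-+ g d (u * b) ⟨
      powℕ g (d + u * b)           ≡⟨ cong (powℕ g) d+u·b≡v·o ⟩
      powℕ g (v * ord g)           ≈⟨ ord∣⇒pow≈ε g (n∣m*n v) ⟩
      ε                            ∎)))
      (∈ℕ-⁻¹ (pow∈ℕ (powℕ g b) u))

  pow∈ℕ⟨pow⟩⇒gcd∣ : ∀ g {a b} → powℕ g a ∈ℕ⟨ powℕ g b ⟩ → gcd b (ord g) ∣ a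
  pow∈ℕ⟨pow⟩⇒gcd∣ g {a} {b} (k , gᵃ≈[gᵇ]ᵏ) = ∣n∣m%n⇒∣m (gcd[m,n]∣n b o)
    (subst (gcd b o ∣_) (sym a%o≡kb%o) (%-presˡ-∣ (∣n⇒∣m*n k (gcd[m,n]∣m b o)) (gcd[m,n]∣n b o)))
    where
    o = ord g
    a%o≡kb%o : a % o ≡ (k * b) % o
    a%o≡kb%o = pow-injective g (m%n<n a o) (m%n<n (k * b) o) (begin
      powℕ g (a % o)       ≈⟨ pow-mod g a ⟨
      powℕ g a             ≈⟨ gᵃ≈[gᵇ]ᵏ ⟩
      powℕ (powℕ g b) k    ≈⟨ pow-* g k b ⟨
      powℕ g (k * b)       ≈⟨ pow-mod g (k * b) ⟩
      powℕ g (k * b % o)   ∎)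

  ∃-maximal-ord : ∃ λ g → ∀ y → ord y ≤ ord g
  ∃-maximal-ord = g , λ y → subst (_≤ ord g) (ord-cong (H.inverseʳ refl))
    (tabulate⁻ (f[xs]≤f[argmax] {f = ord} ε (tabulate H.from)) (H.to y))
    where g = argmax ord ε (tabulate H.from)

module Center {c ℓ} (G : AbelianGroup c ℓ) {n} (H : HasOrder G n) where
  open AbelianGroup G renaming (refl to ≈-refl; sym to ≈-sym; trans to ≈-trans)
  open PowerGraph G
  open Powers G
  open Order G H
  private module H = Inverse H

  ≤⟨⟩⇒∈ℕ : ∀ {x y} → x ≤⟨⟩ y → x ∈ℕ⟨ y ⟩
  ≤⟨⟩⇒∈ℕ {x} x≤y = ∈⟨⟩⇒∈ℕ (x≤y x (∈ℕ⇒∈⟨⟩ (∈ℕ-refl x)))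

  ∈ℕ⇒≤⟨⟩ : ∀ {x y} → x ∈ℕ⟨ y ⟩ → x ≤⟨⟩ y
  ∈ℕ⇒≤⟨⟩ x∈ w w∈ = ∈ℕ⇒∈⟨⟩ (∈ℕ-trans (∈⟨⟩⇒∈ℕ w∈) x∈)

  Dominating : Carrier → Set (c ⊔ ℓ)
  Dominating x = ∀ y → y ∈ℕ⟨ x ⟩ ⊎ x ∈ℕ⟨ y ⟩

  dominating-resp : ∀ {x y} → x ≈ y → Dominating x → Dominating y
  dominating-resp x≈y dom z = Sum.map (∈ℕ-respʳ x≈y) (∈ℕ-respˡ x≈y) (dom z)

  ε-dominating : Dominating ε
  ε-dominating y = inj₂ (ε∈ℕ y)

  dominating⇒EccLe1 : ∀ {x} → Dominating x → EccLe x 1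
  dominating⇒EccLe1 {x} dom y with x ≈? y
  ... | yes x≈y = inj₁ (lift x≈y)
  ... | no  x≉y = inj₂ (y , (x≉y , Sum.swap (Sum.map ∈ℕ⇒≤⟨⟩ ∈ℕ⇒≤⟨⟩ (dom y))) , lift ≈-refl)

  EccLe1⇒dominating : ∀ {x} → EccLe x 1 → Dominating x
  EccLe1⇒dominating {x} ecc y with ecc y
  ... | inj₁ (lift x≈y) = inj₁ (∈ℕ-respˡ x≈y (∈ℕ-refl x))
  ... | inj₂ (z , (_ , inj₁ x≤z) , lift z≈y) = inj₂ (∈ℕ-respʳ z≈y (≤⟨⟩⇒∈ℕ x≤z))
  ... | inj₂ (z , (_ , inj₂ z≤x) , lift z≈y) = inj₁ (∈ℕ-respˡ z≈y (≤⟨⟩⇒∈ℕ z≤x))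

  central⇒dominating : ∀ {x} → Central x → Dominating x
  central⇒dominating central = EccLe1⇒dominating (central ε 1 (dominating⇒EccLe1 ε-dominating))

  ¬EccLe0 : n > 1 → ∀ z → ¬ EccLe z 0
  ¬EccLe0 n>1 z ecc = 0≢1+n (begin
    0                                ≡⟨ Fin.toℕ-fromℕ< 0<n ⟨
    toℕ (fromℕ< 0<n)                 ≡⟨ cong toℕ (H.inverseˡ (≈-trans (≈-sym (lower (ecc _))) (lower (ecc _)))) ⟨
    toℕ (H.to (H.from (fromℕ< n>1))) ≡⟨ cong toℕ (H.inverseˡ ≈-refl) ⟩
    toℕ (fromℕ< n>1)                 ≡⟨ Fin.toℕ-fromℕ< n>1 ⟩
    1                                ∎)
    where
    open ≡-Reasoning
    0<n = <-trans z<s n>1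

  dominating⇒central : n > 1 → ∀ {x} → Dominating x → Central x
  dominating⇒central n>1 dom z zero    ecc = contradiction ecc (¬EccLe0 n>1 z)
  dominating⇒central n>1 {x} dom z (suc e) ecc y = raise e (dominating⇒EccLe1 dom y)
    where
    raise : ∀ e → Within 1 x y → Within (suc e) x y
    raise zero    w = w
    raise (suc e) w = inj₁ (raise e w)

module Cyclic {c ℓ} (G : AbelianGroup c ℓ) {n} (H : HasOrder G n)
  (g : AbelianGroup.Carrier G) (generates : ∀ x → PowerGraph._∈⟨_⟩ G x g) where
  open AbelianGroup G renaming (refl to ≈-refl; sym to ≈-sym; trans to ≈-trans)
  open PowerGraph G
  open Powers G
  open Order G H
  open Center G H
  private module H = Inverse H

  exponent : Carrier → ℕ
  exponent x = proj₁ (∈⟨⟩⇒∈ℕ (generates x)) % ord g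

  exponent-<ord : ∀ x → exponent x < ord g
  exponent-<ord x = m%n<n _ (ord g)

  pow-exponent : ∀ x → powℕ g (exponent x) ≈ x
  pow-exponent x = ≈-sym (≈-trans (proj₂ (∈⟨⟩⇒∈ℕ (generates x))) (pow-mod g _))

  exponent-injective : ∀ {x y} → exponent x ≡ exponent y → x ≈ y
  exponent-injective {x} {y} eq = ≈-trans (≈-sym (pow-exponent x)) (≈-trans (reflexive (cong (powℕ g) eq)) (pow-exponent y))

  exponent-cong : ∀ {x y} → x ≈ y → exponent x ≡ exponent y
  exponent-cong {x} {y} x≈y = pow-injective g (exponent-<ord x) (exponent-<ord y)
    (≈-trans (pow-exponent x) (≈-trans x≈y (≈-sym (pow-exponent y))))

  exponent-pow : ∀ {k} → k < ord g → exponent (powℕ g k) ≡ k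
  exponent-pow k<o = pow-injective g (exponent-<ord _) k<o (pow-exponent _)

  ord-generator : ord g ≡ n
  ord-generator = ≤-antisym
    (Fin.injective⇒≤ {f = λ i → H.to (powℕ g (toℕ i))}
      (λ eq → Fin.toℕ-injective (pow-injective g (Fin.toℕ<n _) (Fin.toℕ<n _) (to-injective eq))))
    (Fin.injective⇒≤ {f = λ i → fromℕ< (exponent-<ord (H.from i))}
      (λ {i} {j} eq → trans (sym (H.inverseˡ ≈-refl))
        (trans (H.to-cong (exponent-injective (Fin.fromℕ<-injective _ _ _ _ eq))) (H.inverseˡ ≈-refl))))

  dominating⇒gcd∣-total : ∀ a → Dominating (powℕ g a) → ∀ b → gcd a n ∣ b ⊎ gcd b n ∣ a
  dominating⇒gcd∣-total a dom b = subst (λ m → gcd a m ∣ b ⊎ gcd b m ∣ a) ord-generator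
    (Sum.map (pow∈ℕ⟨pow⟩⇒gcd∣ g {b} {a}) (pow∈ℕ⟨pow⟩⇒gcd∣ g {a} {b}) (dom (powℕ g b)))

  gcd∣-total⇒dominating : ∀ a → (∀ b → gcd a n ∣ b ⊎ gcd b n ∣ a) → Dominating (powℕ g a)
  gcd∣-total⇒dominating a total y = Sum.map
    (∈ℕ-respˡ (pow-exponent y) ∘ gcd∣⇒pow∈ℕ⟨pow⟩ g {exponent y} {a})
    (∈ℕ-respʳ (pow-exponent y) ∘ gcd∣⇒pow∈ℕ⟨pow⟩ g {a} {exponent y})
    (subst (λ m → gcd a m ∣ exponent y ⊎ gcd (exponent y) m ∣ a) (sym ord-generator) (total (exponent y)))

  prime-power⇒dominating : IsPrimePower n → ∀ x → Dominating x
  prime-power⇒dominating (p , k , pp , _ , n≡p^k) x = dominating-resp (pow-exponent x)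
    (gcd∣-total⇒dominating (exponent x) λ b →
      Sum.map (λ d∣d′ → ∣-trans d∣d′ (gcd[m,n]∣m b n)) (λ d′∣d → ∣-trans d′∣d (gcd[m,n]∣m (exponent x) n))
        (∣p^k-total pp k (gcd∣p^k (exponent x)) (gcd∣p^k b)))
    where
    gcd∣p^k : ∀ m → gcd m n ∣ p ^ k
    gcd∣p^k m = subst (gcd m n ∣_) n≡p^k (gcd[m,n]∣n m n)

  ¬dominating-of-nontrivial-gcd : ¬ IsPrimePower n → ∀ {a} → 0 < a → a < n → 1 < gcd a n →
                                  ¬ Dominating (powℕ g a)
  ¬dominating-of-nontrivial-gcd ¬pp {a} 0<a a<n 1<d dom
    with e , e∣n , d∤e , e∤d ← ¬prime-power⇒incomparable-divisor ¬pp (gcd[m,n]∣n a n) 1<d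
                                 (≤-<-trans (∣⇒≤ {{>-nonZero 0<a}} (gcd[m,n]∣m a n)) a<n)
    with dominating⇒gcd∣-total a dom e
  ... | inj₁ d∣e   = d∤e d∣e
  ... | inj₂ gcd∣a = e∤d (gcd-greatest (subst (_∣ a) (m∣n⇒gcd[m,n]≡m e∣n) gcd∣a) e∣n)

  dominating⇒zeroOrCoprime : ¬ IsPrimePower n → ∀ {a} → a < n → Dominating (powℕ g a) → ZeroOrCoprime n a
  dominating⇒zeroOrCoprime ¬pp {zero}  _   _   = inj₁ refl
  dominating⇒zeroOrCoprime ¬pp {suc a} a<n dom with gcd (suc a) n ≟ 1
  ... | yes gcd≡1 = inj₂ gcd≡1
  ... | no  gcd≢1 = contradiction dom (¬dominating-of-nontrivial-gcd ¬pp z<s a<n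
                      (≤∧≢⇒< (n≢0⇒n>0 (gcd[m,n]≢0 (suc a) n (inj₁ λ ()))) (gcd≢1 ∘ sym)))

  zeroOrCoprime⇒dominating : ∀ {a} → ZeroOrCoprime n a → Dominating (powℕ g a)
  zeroOrCoprime⇒dominating (inj₁ refl)   = ε-dominating
  zeroOrCoprime⇒dominating {a} (inj₂ gcd≡1) = gcd∣-total⇒dominating a λ b → inj₁ (subst (_∣ b) (sym gcd≡1) (1∣ b))

  prime-power⇒CenterCard : n > 1 → IsPrimePower n → CenterCard n
  prime-power⇒CenterCard n>1 pp = record
    { to        = H.to ∘ proj₁
    ; from      = λ i → H.from i , dominating⇒central n>1 (prime-power⇒dominating pp (H.from i))
    ; to-cong   = H.to-cong
    ; from-cong = H.from-cong
    ; inverse   = H.inverseˡ , H.inverseʳ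
    }

  ¬prime-power⇒CenterCard : n > 1 → ¬ IsPrimePower n → CenterCard (φ n + 1)
  ¬prime-power⇒CenterCard n>1 ¬pp =
    subst CenterCard (count-zeroOrCoprime n n>1) (indexing⇒↔Fin-count center-indexing)
    where
    open Counting (zeroOrCoprime? n)
    exponent-<n : ∀ x → exponent x < n
    exponent-<n x = subst (exponent x <_) ord-generator (exponent-<ord x)
    center-indexing : Indexing centerSetoid n
    center-indexing = record
      { index           = exponent ∘ proj₁
      ; index-cong      = exponent-cong
      ; index-injective = exponent-injective
      ; index-<         = exponent-<n ∘ proj₁
      ; index-valid     = λ (x , central) → dominating⇒zeroOrCoprime ¬pp (exponent-<n x)
                            (dominating-resp (≈-sym (pow-exponent x)) (central⇒dominating central))
      ; element         = λ k _ zc → powℕ g k , dominating⇒central n>1 (zeroOrCoprime⇒dominating zc)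
      ; index-element   = λ k k<n _ → exponent-pow (subst (k <_) (sym ord-generator) k<n)
      }

module NonCyclic {c ℓ} (G : AbelianGroup c ℓ) {n} (H : HasOrder G n) where
  open AbelianGroup G renaming (refl to ≈-refl; sym to ≈-sym; trans to ≈-trans)
  open PowerGraph G
  open Powers G
  open Order G H
  open Center G H
  open import Algebra.Properties.Group group using (x≈y⇒x∙y⁻¹≈ε; //-rightDividesˡ)

  ∈ℕ-of-prime-order : ∀ {p w x} → Prime p → powℕ w p ≈ ε → x ∈ℕ⟨ w ⟩ → x ≉ ε → w ∈ℕ⟨ x ⟩
  ∈ℕ-of-prime-order {p} {w} pp wᵖ≈ε (j , x≈wʲ) x≉ε with p ∣? j
  ... | yes p∣j = contradiction (≈-trans x≈wʲ (ord∣⇒pow≈ε w (∣-trans (pow≈ε⇒ord∣ w wᵖ≈ε) p∣j))) x≉ε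
  ... | no  p∤j = ∈ℕ-respʳ (≈-sym x≈wʲ) (∈ℕ-respˡ (identityʳ w) (gcd∣⇒pow∈ℕ⟨pow⟩ w {1} {j}
        (subst (_∣ 1) (sym gcd≡1) ∣-refl)))
    where
    gcd≡1 : gcd j (ord w) ≡ 1
    gcd≡1 = prime∤⇒coprime pp p∤j (∣-trans (gcd[m,n]∣n j (ord w)) (pow≈ε⇒ord∣ w wᵖ≈ε) , gcd[m,n]∣m j (ord w))

  module _ {g} (maximal : ∀ y → ord y ≤ ord g) where

    -- Otherwise, writing ord g = p ^ a * m′ with p ∤ m′, we get p ^ a ∣ k, and
    -- z ^ (k / p ^ a) and g ^ (p ^ a) have coprime orders p ^ (a + 1) and m′.
    maximal-ord⇒p∣ : ∀ {z p k t} → Prime p → ord z ≡ k * p → powℕ z p ≈ powℕ g t → p ∣ t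
    maximal-ord⇒p∣ {z} {p} {k} {t} pp oz≡kp zᵖ≈gᵗ with p ∣? t
    ... | yes p∣t = p∣t
    ... | no  p∤t with a , m′ , og≡p^a*m′ , p∤m′ ← p-part pp (ord g) =
      contradiction (maximal (powℕ z r ∙ powℕ g (p ^ a))) (<⇒≱ larger-order)
      where
      og∣kt : ord g ∣ k * t
      og∣kt = pow≈ε⇒ord∣ g (begin
        powℕ g (k * t)          ≈⟨ pow-* g k t ⟩
        powℕ (powℕ g t) k       ≈⟨ pow-cong k zᵖ≈gᵗ ⟨
        powℕ (powℕ z p) k       ≈⟨ pow-* z k p ⟨
        powℕ z (k * p)          ≡⟨ cong (powℕ z) oz≡kp ⟨
        powℕ z (ord z)          ≈⟨ pow-ord z ⟩
        ε                       ∎)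
        where open SetoidReasoning setoid
      p^a∣k : p ^ a ∣ k
      p^a∣k = coprime-divisor (coprime-^ a (prime∤⇒coprime pp p∤t))
        (subst (p ^ a ∣_) (*-comm k t) (∣-trans (divides m′ (trans og≡p^a*m′ (*-comm (p ^ a) m′))) og∣kt))
      open _∣_ p^a∣k renaming (quotient to r; equality to k≡r*p^a)
      ord-zʳ : ord (powℕ z r) ≡ p * p ^ a
      ord-zʳ = ord-pow z (begin
        ord z             ≡⟨ oz≡kp ⟩
        k * p             ≡⟨ cong (_* p) k≡r*p^a ⟩
        r * p ^ a * p     ≡⟨ *-assoc r (p ^ a) p ⟩
        r * (p ^ a * p)   ≡⟨ *-comm r (p ^ a * p) ⟩
        p ^ a * p * r     ≡⟨ cong (_* r) (*-comm (p ^ a) p) ⟩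
        p * p ^ a * r     ∎)
        where open ≡-Reasoning
      ord-gᵖᵃ : ord (powℕ g (p ^ a)) ≡ m′
      ord-gᵖᵃ = ord-pow g (trans og≡p^a*m′ (*-comm (p ^ a) m′))
      larger-order : ord g < ord (powℕ z r ∙ powℕ g (p ^ a))
      larger-order = begin-strict
        ord g                 ≡⟨ og≡p^a*m′ ⟩
        p ^ a * m′            <⟨ m<m*n (p ^ a * m′) p {{subst NonZero og≡p^a*m′ ord-nonZero}} (prime>1 pp) ⟩
        p ^ a * m′ * p        ≡⟨ *-comm (p ^ a * m′) p ⟩
        p * (p ^ a * m′)      ≡⟨ *-assoc p (p ^ a) m′ ⟨
        p * p ^ a * m′        ≡⟨ cong₂ _*_ ord-zʳ ord-gᵖᵃ ⟨
        ord (powℕ z r) * ord (powℕ g (p ^ a)) ≤⟨ ∣⇒≤ (ord-∙-coprime _ _ (subst₂ Coprime (sym ord-zʳ) (sym ord-gᵖᵃ)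
                                                  (coprime-^ (suc a) (prime∤⇒coprime pp p∤m′)))) ⟩
        ord (powℕ z r ∙ powℕ g (p ^ a)) ∎
        where open ≤-Reasoning

    module _ {x} (dominating : Dominating x) (x≉ε : x ≉ ε) (x∈⟨g⟩ : x ∈ℕ⟨ g ⟩) where

      pth-power-∈ℕ⇒∈ℕ : ∀ {z p k} → Prime p → ord z ≡ k * p → powℕ z p ∈ℕ⟨ g ⟩ → z ∈ℕ⟨ g ⟩
      pth-power-∈ℕ⇒∈ℕ {z} {p} {k} pp oz≡kp (t , zᵖ≈gᵗ) with divides t′ t≡t′p ← maximal-ord⇒p∣ {k = k} {t = t} pp oz≡kp zᵖ≈gᵗ =
        ∈ℕ-respˡ (//-rightDividesˡ (powℕ g t′) z) (∈ℕ-∙ (∈ℕ-trans w∈⟨x⟩ x∈⟨g⟩) (pow∈ℕ g t′))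
        where
        open SetoidReasoning setoid
        w = z ∙ powℕ g t′ ⁻¹
        wᵖ≈ε : powℕ w p ≈ ε
        wᵖ≈ε = begin
          powℕ w p                          ≈⟨ pow-∙ z _ p ⟩
          powℕ z p ∙ powℕ (powℕ g t′ ⁻¹) p ≈⟨ ∙-congˡ (pow-⁻¹ (powℕ g t′) p) ⟩
          powℕ z p ∙ powℕ (powℕ g t′) p ⁻¹ ≈⟨ x≈y⇒x∙y⁻¹≈ε (begin
            powℕ z p                          ≈⟨ zᵖ≈gᵗ ⟩
            powℕ g t                          ≡⟨ cong (powℕ g) (trans t≡t′p (*-comm t′ p)) ⟩
            powℕ g (p * t′)                   ≈⟨ pow-* g p t′ ⟩
            powℕ (powℕ g t′) p                ∎) ⟩
          ε                                 ∎
        w∈⟨x⟩ : w ∈ℕ⟨ x ⟩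
        w∈⟨x⟩ = Sum.[ (λ w∈⟨x⟩ → w∈⟨x⟩) , (λ x∈⟨w⟩ → ∈ℕ-of-prime-order pp wᵖ≈ε x∈⟨w⟩ x≉ε) ]′ (dominating w)

      maximal-generates : ∀ z → z ∈ℕ⟨ g ⟩
      maximal-generates z = <-rec (λ K → ∀ z → ord z ≡ K → z ∈ℕ⟨ g ⟩) step (ord z) z refl
        where
        step : ∀ K → (∀ {K′} → K′ < K → ∀ z → ord z ≡ K′ → z ∈ℕ⟨ g ⟩) → ∀ z → ord z ≡ K → z ∈ℕ⟨ g ⟩
        step 0 _ z oz≡0 = contradiction oz≡0 (≢-nonZero⁻¹ (ord z))
        step 1 _ z oz≡1 = ∈ℕ-respˡ (≈-sym (ord≡1⇒≈ε oz≡1)) (ε∈ℕ g)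
        step K@(suc (suc _)) rec z oz≡K with p , pp , divides k K≡kp ← ∃-prime-∣ (s≤s (s≤s z≤n)) =
          pth-power-∈ℕ⇒∈ℕ {k = k} pp oz≡kp (rec k<K (powℕ z p) (ord-pow z oz≡kp))
          where
          oz≡kp : ord z ≡ k * p
          oz≡kp = trans oz≡K K≡kp
          k<K : k < K
          k<K = subst (k <_) (sym K≡kp) (m<m*n k p {{m*n≢0⇒m≢0 k {{subst NonZero K≡kp _}}}} (prime>1 pp))

  dominating⇒cyclic : ∀ {x} → Dominating x → x ≉ ε → IsCyclic
  dominating⇒cyclic {x} dominating x≉ε with g₀ , maximal₀ ← ∃-maximal-ord with dominating g₀
  ... | inj₁ g₀∈⟨x⟩ = x , λ z → ∈ℕ⇒∈⟨⟩ (maximal-generates maximal dominating x≉ε (∈ℕ-refl x) z)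
    where maximal : ∀ y → ord y ≤ ord x
          maximal y = ≤-trans (maximal₀ y) (∣⇒≤ (∈ℕ⇒ord∣ g₀∈⟨x⟩))
  ... | inj₂ x∈⟨g₀⟩ = g₀ , λ z → ∈ℕ⇒∈⟨⟩ (maximal-generates maximal₀ dominating x≉ε x∈⟨g₀⟩ z)

  ¬cyclic⇒CenterCard : n > 1 → ¬ IsCyclic → CenterCard 1
  ¬cyclic⇒CenterCard n>1 ¬cyclic = record
    { to        = λ _ → Fin.zero
    ; from      = λ _ → ε , dominating⇒central n>1 ε-dominating
    ; to-cong   = λ _ → refl
    ; from-cong = λ _ → ≈-refl
    ; inverse   = (λ { {Fin.zero} _ → refl }) , (λ { {x , central} _ → ≈-sym (central⇒≈ε central) })
    }
    where
    central⇒≈ε : ∀ {x} → Central x → x ≈ ε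
    central⇒≈ε {x} central with x ≈? ε
    ... | yes x≈ε = x≈ε
    ... | no  x≉ε = contradiction (dominating⇒cyclic (central⇒dominating central) x≉ε) ¬cyclic

proposition3 : {c ℓ : Level} (G : AbelianGroup c ℓ) (n : ℕ) → HasOrder G n → n > 1 →
    ((PowerGraph.IsCyclic G → ¬ (∃ λ p → ∃ λ k → Prime p × k ≥ 1 × n ≡ p ^ k) → PowerGraph.CenterCard G (φ n + 1))
    × (PowerGraph.IsCyclic G → (∃ λ p → ∃ λ k → Prime p × k ≥ 1 × n ≡ p ^ k) → PowerGraph.CenterCard G n)
    × (¬ PowerGraph.IsCyclic G → PowerGraph.CenterCard G 1))
proposition3 G n H n>1 =
    (λ (g , generates) → Cyclic.¬prime-power⇒CenterCard G H g generates n>1)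
  , (λ (g , generates) → Cyclic.prime-power⇒CenterCard G H g generates n>1)
  , NonCyclic.¬cyclic⇒CenterCard G H n>1
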